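{- Assume $n,m$ are not both odd, the set of critical numbers is nonempty and $l_1>l_1'$. For every integer $s$, the vectors $u,v=v(s)\in\mathbb{Z}^{2r}$ defined in the context lie in $X_0^+(2r)$, and $u_i+u_{2r+1-i}=-w$, $v_i+v_{2r+1-i}=w'+n-m-1-2s$ for all $i$.
   Context: For $N\ge1$ let $L_0^+(N)$ be the set of $(w,l)\in\mathbb{Z}\times\mathbb{Z}^N$ with $l_1>\dots>l_N$, $l_i+l_{N+1-i}=0$ and $w+l_i\equiv N+1\bmod2$; $X_0^+(N)$ is the set of $x\in\mathbb{Z}^N$ with $x_1\ge\dots\ge x_N$ and $x_i+x_{N+1-i}$ independent of $i$. Fix $n,m\ge1$, $(w,l)\in L_0^+(n)$, $(w',l')\in L_0^+(m)$, $\delta,\delta'\in\{0,1\}$. In Knapp's notation for $W_{\mathbb{R}}$, $(l,t)$ ($l\ge1$) is irreducible $2$-dimensional and $(\mathrm{sgn}^\epsilon,t)$ is $1$-dimensional, $L(s,(l,t))=\Gamma_{\mathbb{C}}(s+t+\frac l2)$, $L(s,(\mathrm{sgn}^\epsilon,t))=\Gamma_{\mathbb{R}}(s+t+\epsilon)$, $\Gamma_{\mathbb{R}}(s)=\pi^{ -s/2}\Gamma(s/2)$, $\Gamma_{\mathbb{C}}(s)=2(2\pi)^{ -s}\Gamma(s)$; multiplicative over constituents. $\pi_\infty^W=\bigoplus_{i\le n/2}(l_i,-w/2)$ plus $(\mathrm{sgn}^\delta,-w/2)$ if $n$ odd; $\sigma_\infty^W$ analogously; $\tau=\pi_\infty^W\otimes\sigma_\infty^W$.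 $t\in\frac{n+m}{2}+\mathbb{Z}$ is critical if neither $L(s,\tau)$ nor $L(1-s,\check\tau)$ has a pole at $s=t$. $\mu_i=\frac{w+l_i+2i-1-n}{2}$, $\check\mu_i=-\mu_{n+1-i}$, $\nu_j=\frac{w'+l'_j+2j-1-m}{2}$. Position tuple: $a_j$ unique integer with $1\le a_j\le n-1$ and $l_{a_j}>l'_j\ge l_{1+a_j}$. Jump indices: $j\in\{1,\dots,m-1\}$ with $a_j<a_{j+1}$, listed $j_1<\dots<j_k$; $j_0=0$, $j_{k+1}=m$, $r=k+1$. $\lambda_j=\nu_j+a_j-j$. For $\rho=1,\dots,r$: $u_{2\rho-1}=\check\mu_{a_{j_\rho}}$, $u_{2\rho}=\check\mu_{1+a_{j_\rho}}$, $v_{2\rho-1}=\lambda_{1+j_{\rho-1}}-s$, $v_{2\rho}=\lambda_{j_\rho}-s$. -}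

module Defs where

open import Data.Nat as ℕ using (ℕ; zero; suc; _∸_; _<?_)
open import Data.Integer as ℤ using (ℤ; +_; -_; _-_; ∣_∣; _≟_)
open import Data.Integer.DivMod using (_/ℕ_)
open import Data.List using (List; []; _∷_; _++_; map; concatMap; filter; upTo; length; [_])
open import Data.List.Relation.Unary.All using (All)
open import Data.Product using (Σ; _×_; ∃)
open import Relation.Nullary using (¬_; yes; no)
open import Relation.Binary.PropositionalEquality using (_≡_)

-- Conventions: a vector x ∈ ℤ^N is represented by a function x : ℕ → ℤ
-- whose values at the (1-based) indices 1 … N are the coordinates; values
-- at other indices are irrelevant and never constrained or used.

range1 : ℕ → List ℕ
range1 k = map suc (upTo k)

Odd : ℕ → Set
Odd N = N ℕ.% 2 ≡ 1

record InL0+ (N : ℕ) (w : ℤ) (l : ℕ → ℤ) : Set where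
  field
    decr   : ∀ i → 1 ℕ.≤ i → i ℕ.< N → l (suc i) ℤ.< l i
    antisym : ∀ i → 1 ℕ.≤ i → i ℕ.≤ N → l i ℤ.+ l (suc N ∸ i) ≡ + 0
    parity : ∀ i → 1 ℕ.≤ i → i ℕ.≤ N → ∃ λ k → w ℤ.+ l i ≡ + suc N ℤ.+ (+ 2) ℤ.* k

InX0+ : (N : ℕ) → (ℕ → ℤ) → Set
InX0+ N x = (∀ i → 1 ℕ.≤ i → i ℕ.< N → x (suc i) ℤ.≤ x i)
          × ∃ λ c → ∀ i → 1 ℕ.≤ i → i ℕ.≤ N → x i ℤ.+ x (suc N ∸ i) ≡ c

-- Weil group representations (Knapp's notation).  The real parameter t
-- is stored doubled (T = 2t ∈ ℤ), since t ∈ ½ℤ throughout.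

data WC : Set where
  two : (l : ℤ) (T : ℤ) → WC   -- (l, t), 2-dimensional, T = 2t
  sgn : (ε : ℕ) (T : ℤ) → WC   -- (sgn^ε, t), 1-dimensional, T = 2t

_⊗_ : WC → WC → List WC
two l T ⊗ two l' T' with l ≟ l'
... | yes _ = two (l ℤ.+ l') (T ℤ.+ T') ∷ sgn 0 (T ℤ.+ T') ∷ sgn 1 (T ℤ.+ T') ∷ []
... | no _  = two (l ℤ.+ l') (T ℤ.+ T') ∷ two (+ ∣ l - l' ∣) (T ℤ.+ T') ∷ []
two l T ⊗ sgn ε T' = [ two l (T ℤ.+ T') ]
sgn ε T ⊗ two l T' = [ two l (T ℤ.+ T') ]
sgn ε T ⊗ sgn ε' T' = [ sgn ((ε ℕ.+ ε') ℕ.% 2) (T ℤ.+ T') ]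

tensor : List WC → List WC → List WC
tensor π σ = concatMap (λ p → concatMap (λ q → p ⊗ q) σ) π

dual : WC → WC
dual (two l T) = two l (- T)
dual (sgn ε T) = sgn ε (- T)

-- Γ_ℂ(x) has a pole iff x ∈ {0,-1,-2,…};  argument given doubled (X = 2x)
PoleΓℂ : ℤ → Set
PoleΓℂ X = ∃ λ k → X ≡ - (+ (2 ℕ.* k))

-- Γ_ℝ(x) = π^{-x/2} Γ(x/2) has a pole iff x ∈ {0,-2,-4,…};  X = 2x
PoleΓℝ : ℤ → Set
PoleΓℝ X = ∃ λ k → X ≡ - (+ (4 ℕ.* k))

-- L(s, c) has a pole at s, where S = 2s:
--   L(s,(l,t)) = Γ_ℂ(s + t + l/2),  L(s,(sgn^ε,t)) = Γ_ℝ(s + t + ε)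
LPole : WC → ℤ → Set
LPole (two l T) S = PoleΓℂ (S ℤ.+ T ℤ.+ l)
LPole (sgn ε T) S = PoleΓℝ (S ℤ.+ T ℤ.+ + (2 ℕ.* ε))

oddPart : ℕ → ℕ → ℤ → List WC
oddPart N δ T with N ℕ.% 2
... | zero  = []
... | suc _ = [ sgn δ T ]

-- π_∞^W = ⊕_{i ≤ N/2} (l_i, -w/2)  (⊕ (sgn^δ, -w/2) if N odd)
piW : ℕ → ℤ → (ℕ → ℤ) → ℕ → List WC
piW N w l δ = map (λ i → two (l i) (- w)) (range1 (N ℕ./ 2)) ++ oddPart N δ (- w)

-- t (given as S = 2t) is critical for τ:  t ∈ (n+m)/2 + ℤ and neither
-- L(s,τ) nor L(1-s, τ̌) has a pole at s = t.  Since L is a finite product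
-- of Gamma factors (which never vanish), it has a pole iff some factor does.
Critical : ℕ → ℕ → List WC → ℤ → Set
Critical n m τ S =
  (∃ λ k → S ≡ + (n ℕ.+ m) ℤ.+ (+ 2) ℤ.* k)
  × All (λ c → ¬ LPole c S × ¬ LPole (dual c) (+ 2 - S)) τ

IsPosTuple : (N M : ℕ) → (ℕ → ℤ) → (ℕ → ℤ) → (ℕ → ℕ) → Set
IsPosTuple N M l l' a = ∀ j → 1 ℕ.≤ j → j ℕ.≤ M →
  1 ℕ.≤ a j × a j ℕ.≤ N ∸ 1 × l' j ℤ.< l (a j) × l (suc (a j)) ℤ.≤ l' j

-- μ_i = (w + l_i + 2i - 1 - N)/2  (an integer under the L_0^+ parity condition)
mu : ℕ → ℤ → (ℕ → ℤ) → ℕ → ℤ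
mu N w l i = (w ℤ.+ l i ℤ.+ + (2 ℕ.* i) - + 1 - + N) /ℕ 2

muˇ : ℕ → ℤ → (ℕ → ℤ) → ℕ → ℤ
muˇ N w l i = - mu N w l (suc N ∸ i)

lam : ℕ → ℤ → (ℕ → ℤ) → (ℕ → ℕ) → ℕ → ℤ
lam M w' l' a j = mu M w' l' j ℤ.+ + a j - + j

jumps : ℕ → (ℕ → ℕ) → List ℕ
jumps M a = filter (λ j → a j <? a (suc j)) (range1 (M ∸ 1))

rr : ℕ → (ℕ → ℕ) → ℕ
rr M a = suc (length (jumps M a))

nth : List ℕ → ℕ → ℕ
nth [] _ = 0
nth (x ∷ xs) zero = x
nth (x ∷ xs) (suc i) = nth xs i

jAt : ℕ → (ℕ → ℕ) → ℕ → ℕ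
jAt M a ρ = nth (0 ∷ jumps M a ++ [ M ]) ρ

-- the vector with entries f 1, g 1, f 2, g 2, …  (1-based: x_{2ρ-1} = f ρ, x_{2ρ} = g ρ)
interleave : (ℕ → ℤ) → (ℕ → ℤ) → ℕ → ℤ
interleave f g zero = + 0
interleave f g (suc zero) = f 1
interleave f g (suc (suc zero)) = g 1
interleave f g (suc (suc (suc i))) = interleave (λ k → f (suc k)) (λ k → g (suc k)) (suc i)

uVec : ℕ → ℤ → (ℕ → ℤ) → ℕ → (ℕ → ℕ) → ℕ → ℤ
uVec N w l M a = interleave (λ ρ → muˇ N w l (a (jAt M a ρ)))
                            (λ ρ → muˇ N w l (suc (a (jAt M a ρ))))

vVec : ℕ → ℤ → (ℕ → ℤ) → (ℕ → ℕ) → ℤ → ℕ → ℤ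
vVec M w' l' a s = interleave (λ ρ → lam M w' l' a (suc (jAt M a (ρ ∸ 1))) - s)
                              (λ ρ → lam M w' l' a (jAt M a ρ) - s)

-- A tie lᵢ = l'ⱼ is impossible. At a positive entry it puts (sgn⁰, t) ⊕ (sgn¹, t) into τ with
-- s + t integral for every critical s, and one of the four Γ_ℝ factors of L(s, τ) L(1 - s, τ̌) then
-- has a pole; a tie at 0 forces n and m to be odd, and negative ties reflect to positive ones.
-- Without ties the position of l'ⱼ among the lᵢ is strict on both sides, so the symmetries
-- lᵢ + l_{n+1-i} = 0 and l'ⱼ + l'_{m+1-j} = 0 give a_{m+1-j} = n - a_j. Hence the jump indices are
-- symmetric, j_{r-ρ} = m - j_ρ, and a is constant between consecutive jumps, which pairs u_i with
-- u_{2r+1-i} through μ̌_i + μ̌_{n+1-i} = -w and v_i with v_{2r+1-i} through λ_j + λ_{m+1-j}. Monotonicity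
-- comes from consecutive lᵢ differing by at least 2 (they have equal parity), which makes μ̌ and λ
-- decreasing.

module Submission where

open import Defs
open import Data.Nat as ℕ using (ℕ; zero; suc; _∸_; z≤n; s≤s; _<?_)
import Data.Nat.Properties as ℕP
import Data.Nat.DivMod as ℕD
open import Data.Integer as ℤ using (ℤ; +_; -_; -[1+_]; _-_; _+_; _*_)
import Data.Integer.Properties as ℤP
open import Data.Integer.DivMod using (_/ℕ_; _%ℕ_; a≡a%ℕn+[a/ℕn]*n; n%ℕd<d)
open import Data.Integer.Tactic.RingSolver using (solve-∀)
open import Data.List using (List; []; _∷_; _++_; [_]; length; applyUpTo)
import Data.List.Properties as Listₚ
open import Data.List.Relation.Unary.All as All using (All; []; _∷_)
import Data.List.Relation.Unary.All.Properties as Allₚ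
open import Data.List.Relation.Unary.AllPairs using (AllPairs; []; _∷_)
import Data.List.Relation.Unary.AllPairs.Properties as AllPairsₚ
open import Data.List.Relation.Unary.Any using (here; there)
open import Data.List.Membership.Propositional using (_∈_)
open import Data.List.Membership.Propositional.Properties
  using (∈-map⁺; ∈-upTo⁺; ∈-applyUpTo⁻; ∈-applyUpTo⁺; ∈-filter⁺; ∈-filter⁻; ∈-++⁺ˡ; ∈-++⁺ʳ; ∈-++⁻)
open import Data.Product using (Σ; ∃; _×_; _,_; proj₁; proj₂)
open import Data.Sum using (_⊎_; inj₁; inj₂)
open import Data.Empty using (⊥; ⊥-elim)
open import Relation.Nullary using (¬_; yes; no)
open import Relation.Binary.Definitions using (Tri; tri<; tri≈; tri>)
open import Relation.Binary.PropositionalEquality hiding ([_]; J)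

module Arithmetic where
  open import Data.Integer using (_≤_; _<_)

  double : ℕ → ℕ
  double zero    = zero
  double (suc p) = suc (suc (double p))

  double≡2* : ∀ p → double p ≡ 2 ℕ.* p
  double≡2* zero    = refl
  double≡2* (suc p) = cong suc (trans (cong suc (double≡2* p)) (sym (ℕP.+-suc p (p ℕ.+ 0))))

  even-or-odd : ∀ n → ∃ λ p → n ≡ double p ⊎ n ≡ suc (double p)
  even-or-odd zero = 0 , inj₁ refl
  even-or-odd (suc n) with even-or-odd n
  ... | p , inj₁ e = p , inj₂ (cong suc e)
  ... | p , inj₂ e = suc p , inj₁ (cong suc e)

  Odd-suc[p+p] : ∀ p → Odd (suc (p ℕ.+ p))
  Odd-suc[p+p] zero    = refl
  Odd-suc[p+p] (suc p) = trans (cong (λ t → suc t ℕ.% 2) (ℕP.+-suc (suc p) p)) (Odd-suc[p+p] p)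

  pos-double : ∀ p → + double p ≡ + 2 * + p
  pos-double p = trans (cong +_ (double≡2* p)) (ℤP.pos-* 2 p)

  pos-∸ : ∀ {m n} → n ℕ.≤ m → + (m ∸ n) ≡ + m - + n
  pos-∸ {m} {n} n≤m = trans (sym (ℤP.⊖-≥ n≤m)) (sym (ℤP.m-n≡m⊖n m n))

  -- Inequalities with an explicit slack: chains of them become ring identities.
  infix 4 _≼_
  _≼_ : ℤ → ℤ → Set
  a ≼ b = ∃ λ k → b ≡ a + + k

  ≤⇒≼ : ∀ {a b} → a ≤ b → a ≼ b
  ≤⇒≼ {a} {b} a≤b = ℤ.∣ b - a ∣ ,
    trans (b≡a+[b-a] a b) (cong (λ t → a + t) (sym (ℤP.0≤i⇒+∣i∣≡i (ℤP.i≤j⇒0≤j-i a≤b))))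
    where
    b≡a+[b-a] : ∀ a b → b ≡ a + (b - a)
    b≡a+[b-a] = solve-∀

  ≼⇒≤ : ∀ {a b} → a ≼ b → a ≤ b
  ≼⇒≤ {a} (k , refl) = ℤP.i≤i+j a (+ k)

  <⇒1+≼ : ∀ {a b} → a < b → a + + 1 ≼ b
  <⇒1+≼ {a} a<b = ≤⇒≼ (subst (_≤ _) (ℤP.+-comm (+ 1) a) (ℤP.i<j⇒suc[i]≤j a<b))

  2*≼2*⇒≤ : ∀ {a b} → + 2 * a ≼ + 2 * b → a ≤ b
  2*≼2*⇒≤ {a} {b} p = ℤP.*-cancelˡ-≤-pos a b (+ 2) (≼⇒≤ p)

  2*-injective : ∀ {a b} → + 2 * a ≡ + 2 * b → a ≡ b
  2*-injective {a} {b} = ℤP.*-cancelˡ-≡ (+ 2) a b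

  2*≢2*+1 : ∀ x y → + 2 * x ≢ + 2 * y + + 1
  2*≢2*+1 x y e = 2*≢1 (x - y) (begin
    + 2 * (x - y)           ≡⟨ distrib x y ⟩
    + 2 * x - + 2 * y       ≡⟨ cong (_- + 2 * y) e ⟩
    + 2 * y + + 1 - + 2 * y ≡⟨ cancel y ⟩
    + 1                     ∎)
    where
    open ≡-Reasoning
    2*≢1 : ∀ t → + 2 * t ≢ + 1
    2*≢1 (+ zero)  ()
    2*≢1 (+ suc k) e = ℕP.m+1+n≢0 k (ℕP.suc-injective (ℤP.+-injective e))
    2*≢1 -[1+ k ]  ()
    distrib : ∀ x y → + 2 * (x - y) ≡ + 2 * x - + 2 * y
    distrib = solve-∀
    cancel : ∀ y → + 2 * y + + 1 - + 2 * y ≡ + 1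
    cancel = solve-∀

  2*/ℕ2 : ∀ {x} z → x ≡ + 2 * z → x /ℕ 2 ≡ z
  2*/ℕ2 {x} z e with x %ℕ 2 | a≡a%ℕn+[a/ℕn]*n x 2 | n%ℕd<d x 2
  ... | zero | x≡ | _ = 2*-injective (trans (sym (trans x≡ (shape₀ (x /ℕ 2)))) e)
    where
    shape₀ : ∀ q → + 0 + q * + 2 ≡ + 2 * q
    shape₀ = solve-∀
  ... | suc zero | x≡ | _ = ⊥-elim (2*≢2*+1 z (x /ℕ 2) (trans (sym e) (trans x≡ (shape₁ (x /ℕ 2)))))
    where
    shape₁ : ∀ q → + 1 + q * + 2 ≡ + 2 * q + + 1
    shape₁ = solve-∀
  ... | suc (suc _) | _ | s≤s (s≤s ())

  reflect-≥1 : ∀ {N i} → i ℕ.≤ N → 1 ℕ.≤ suc N ∸ i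
  reflect-≥1 {N} {i} i≤N = subst (1 ℕ.≤_) (sym (ℕP.+-∸-assoc 1 i≤N)) (s≤s z≤n)

  reflect-≤ : ∀ {N i} → 1 ℕ.≤ i → suc N ∸ i ℕ.≤ N
  reflect-≤ {N} {suc i} _ = ℕP.m∸n≤m N i

  reflect-involutive : ∀ {N i} → i ℕ.≤ N → suc N ∸ (suc N ∸ i) ≡ i
  reflect-involutive i≤N = ℕP.m∸[m∸n]≡n (ℕP.m≤n⇒m≤1+n i≤N)

open Arithmetic

module Weight {N : ℕ} {w : ℤ} {l : ℕ → ℤ} (hl : InL0+ N w l) where
  open import Data.Integer using (_≤_; _<_)
  open InL0+ hl

  private
    gap-parity : ∀ w l' M k k' E → w + (l' + + 1 + E) ≡ M + + 2 * k → w + l' ≡ M + + 2 * k' →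
                 + 2 * k ≡ + 2 * k' + + 1 + E
    gap-parity w l' M k k' E e e' = begin
      + 2 * k                      ≡⟨ shift M k ⟩
      (M + + 2 * k) - M            ≡⟨ cong (_- M) e ⟨
      w + (l' + + 1 + E) - M       ≡⟨ regroup w l' E M ⟩
      (w + l') + + 1 + E - M       ≡⟨ cong (λ t → t + + 1 + E - M) e' ⟩
      (M + + 2 * k') + + 1 + E - M ≡⟨ unshift M k' E ⟩
      + 2 * k' + + 1 + E           ∎
      where
      open ≡-Reasoning
      shift : ∀ M k → + 2 * k ≡ (M + + 2 * k) - M
      shift = solve-∀
      regroup : ∀ w l' E M → w + (l' + + 1 + E) - M ≡ (w + l') + + 1 + E - M
      regroup = solve-∀
      unshift : ∀ M k' E → (M + + 2 * k') + + 1 + E - M ≡ + 2 * k' + + 1 + E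
      unshift = solve-∀

  -- Consecutive entries of l have the same parity (that of N + 1 - w), so they differ by at least 2.
  l-step : ∀ i → 1 ℕ.≤ i → i ℕ.< N → l (suc i) + + 2 ≼ l i
  l-step i 1≤i i<N with parity i 1≤i (ℕP.<⇒≤ i<N) | parity (suc i) (ℕP.m≤n⇒m≤1+n 1≤i) i<N
                      | <⇒1+≼ (decr i 1≤i i<N)
  ... | k , wli | k' , wli' | e , li≡
    with gap-parity w (l (suc i)) (+ suc N) k k' (+ e) (trans (cong (λ t → w + t) (sym li≡)) wli) wli'
  ...   | 2k≡ with e
  ...     | zero   = ⊥-elim (2*≢2*+1 k k' (trans 2k≡ (ℤP.+-identityʳ _)))
  ...     | suc e' = e' , trans li≡ (regroup (l (suc i)) (+ e'))
    where
    regroup : ∀ a b → a + + 1 + (+ 1 + b) ≡ a + + 2 + b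
    regroup = solve-∀

  l-gap : ∀ i i' → 1 ℕ.≤ i → i ℕ.≤ i' → i' ℕ.≤ N → l i' + + 2 * + (i' ∸ i) ≼ l i
  l-gap i i' 1≤i i≤i' i'≤N
    with gap (i' ∸ i) (subst (ℕ._≤ N) (sym (ℕP.m∸n+n≡m i≤i')) i'≤N)
    where
    gap : ∀ d → d ℕ.+ i ℕ.≤ N → l (d ℕ.+ i) + + 2 * + d ≼ l i
    gap zero _ = 0 , sym (trans (ℤP.+-identityʳ _) (ℤP.+-identityʳ (l i)))
    gap (suc d) d+i<N with l-step (d ℕ.+ i) (ℕP.≤-trans 1≤i (ℕP.m≤n+m i d)) d+i<N | gap d (ℕP.<⇒≤ d+i<N)
    ... | s , ld≡ | s' , li≡ = s ℕ.+ s' , chain (l (suc (d ℕ.+ i))) _ _ (+ d) (+ s) (+ s') ld≡ li≡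
      where
      chain : ∀ b a c D S S' → a ≡ b + + 2 + S → c ≡ a + + 2 * D + S' →
              c ≡ b + + 2 * (+ 1 + D) + (S + S')
      chain b _ _ D S S' refl refl = regroup b D S S'
        where
        regroup : ∀ b D S S' → b + + 2 + S + + 2 * D + S' ≡ b + + 2 * (+ 1 + D) + (S + S')
        regroup = solve-∀
  ... | s , e rewrite ℕP.m∸n+n≡m i≤i' = s , e

  l-antitone : ∀ i i' → 1 ℕ.≤ i → i ℕ.≤ i' → i' ℕ.≤ N → l i' ≤ l i
  l-antitone i i' 1≤i i≤i' i'≤N with l-gap i i' 1≤i i≤i' i'≤N
  ... | s , e = ≼⇒≤ (2 ℕ.* (i' ∸ i) ℕ.+ s ,
                      trans e (trans (cong (λ t → l i' + t + + s) (sym (ℤP.pos-* 2 (i' ∸ i))))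
                                     (ℤP.+-assoc (l i') _ (+ s))))

  l-strictAnti : ∀ i i' → 1 ℕ.≤ i → i ℕ.< i' → i' ℕ.≤ N → l i' < l i
  l-strictAnti i i' 1≤i i<i' i'≤N =
    ℤP.≤-<-trans (l-antitone (suc i) i' (ℕP.m≤n⇒m≤1+n 1≤i) i<i' i'≤N) (decr i 1≤i (ℕP.<-≤-trans i<i' i'≤N))

  l-reflect : ∀ i → 1 ℕ.≤ i → i ℕ.≤ N → l (suc N ∸ i) ≡ - l i
  l-reflect i 1≤i i≤N = neg-unique (l i) _ (antisym i 1≤i i≤N)
    where
    neg-unique : ∀ a b → a + b ≡ + 0 → b ≡ - a
    neg-unique a b e = trans (shift a b) (trans (cong (λ t → - a + t) e) (ℤP.+-identityʳ (- a)))
      where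
      shift : ∀ a b → b ≡ - a + (a + b)
      shift = solve-∀

  2*mu : ∀ i → 1 ℕ.≤ i → i ℕ.≤ N → + 2 * mu N w l i ≡ w + l i + + 2 * + i - + 1 - + N
  2*mu i 1≤i i≤N with parity i 1≤i i≤N
  ... | k , wli = trans (cong (+ 2 *_) (2*/ℕ2 (k + + i) numerator≡)) (sym numerator≡′)
    where
    regroup : ∀ k I N → (+ 1 + N + + 2 * k) + + 2 * I - + 1 - N ≡ + 2 * (k + I)
    regroup = solve-∀
    numerator≡′ : w + l i + + 2 * + i - + 1 - + N ≡ + 2 * (k + + i)
    numerator≡′ = trans (cong (λ t → t + + 2 * + i - + 1 - + N) wli) (regroup k (+ i) (+ N))
    numerator≡ : w + l i + + (2 ℕ.* i) - + 1 - + N ≡ + 2 * (k + + i)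
    numerator≡ = trans (cong (λ t → w + l i + t - + 1 - + N) (ℤP.pos-* 2 i)) numerator≡′

  mu-reflect : ∀ i → 1 ℕ.≤ i → i ℕ.≤ N → mu N w l i + mu N w l (suc N ∸ i) ≡ w
  mu-reflect i 1≤i i≤N = 2*-injective (begin
    + 2 * (mu N w l i + mu N w l i')               ≡⟨ distrib (mu N w l i) (mu N w l i') ⟩
    + 2 * mu N w l i + + 2 * mu N w l i'           ≡⟨ cong₂ _+_ (2*mu i 1≤i i≤N) 2*mu-i' ⟩
    (w + l i + + 2 * + i - + 1 - + N) +
      (w + l i' + + 2 * (+ 1 + + N - + i) - + 1 - + N) ≡⟨ regroup w (l i) (l i') (+ i) (+ N) ⟩
    + 2 * w + (l i + l i')                        ≡⟨ cong (λ t → + 2 * w + t) (antisym i 1≤i i≤N) ⟩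
    + 2 * w + + 0                                 ≡⟨ ℤP.+-identityʳ _ ⟩
    + 2 * w                                       ∎)
    where
    open ≡-Reasoning
    i' = suc N ∸ i
    2*mu-i' : + 2 * mu N w l i' ≡ w + l i' + + 2 * (+ 1 + + N - + i) - + 1 - + N
    2*mu-i' = trans (2*mu i' (reflect-≥1 i≤N) (reflect-≤ 1≤i))
                    (cong (λ t → w + l i' + + 2 * t - + 1 - + N) (pos-∸ (ℕP.m≤n⇒m≤1+n i≤N)))
    distrib : ∀ a b → + 2 * (a + b) ≡ + 2 * a + + 2 * b
    distrib = solve-∀
    regroup : ∀ w li li' I N → w + li + + 2 * I - + 1 - N + (w + li' + + 2 * (+ 1 + N - I) - + 1 - N)
                              ≡ + 2 * w + (li + li')
    regroup = solve-∀

  mu-antitone : ∀ i i' → 1 ℕ.≤ i → i ℕ.≤ i' → i' ℕ.≤ N → mu N w l i' ≤ mu N w l i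
  mu-antitone i i' 1≤i i≤i' i'≤N with l-gap i i' 1≤i i≤i' i'≤N
  ... | s , li≡ = 2*≼2*⇒≤ (s , chain w (l i) (l i') (+ i) (+ i') (+ N) (+ s) _ _
                                  (2*mu i 1≤i (ℕP.≤-trans i≤i' i'≤N)) (2*mu i' (ℕP.≤-trans 1≤i i≤i') i'≤N)
                                  (trans li≡ (cong (λ t → l i' + + 2 * t + + s) (pos-∸ i≤i'))))
    where
    chain : ∀ w li li' I I' N S A A' → A ≡ w + li + + 2 * I - + 1 - N → A' ≡ w + li' + + 2 * I' - + 1 - N →
            li ≡ li' + + 2 * (I' - I) + S → A ≡ A' + S
    chain w _ li' I I' N S _ _ refl refl refl = regroup w li' I I' N S
      where
      regroup : ∀ w li' I I' N S → w + (li' + + 2 * (I' - I) + S) + + 2 * I - + 1 - N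
                                   ≡ w + li' + + 2 * I' - + 1 - N + S
      regroup = solve-∀

  muˇ-reflect : ∀ i → 1 ℕ.≤ i → i ℕ.≤ N → muˇ N w l i + muˇ N w l (suc N ∸ i) ≡ - w
  muˇ-reflect i 1≤i i≤N = begin
    - μ (suc N ∸ i) + - μ (suc N ∸ (suc N ∸ i)) ≡⟨ cong (λ t → - μ (suc N ∸ i) + - μ t) (reflect-involutive i≤N) ⟩
    - μ (suc N ∸ i) + - μ i                     ≡⟨ ℤP.neg-distrib-+ (μ (suc N ∸ i)) (μ i) ⟨
    - (μ (suc N ∸ i) + μ i)                     ≡⟨ cong -_ (ℤP.+-comm (μ (suc N ∸ i)) (μ i)) ⟩
    - (μ i + μ (suc N ∸ i))                     ≡⟨ cong -_ (mu-reflect i 1≤i i≤N) ⟩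
    - w                                         ∎
    where
    open ≡-Reasoning
    μ : ℕ → ℤ
    μ = mu N w l

  muˇ-antitone : ∀ i i' → 1 ℕ.≤ i → i ℕ.≤ i' → i' ℕ.≤ N → muˇ N w l i' ≤ muˇ N w l i
  muˇ-antitone i i' 1≤i i≤i' i'≤N = ℤP.neg-mono-≤
    (mu-antitone (suc N ∸ i') (suc N ∸ i) (reflect-≥1 i'≤N) (ℕP.∸-monoʳ-≤ (suc N) i≤i') (reflect-≤ 1≤i))

  l-pos⇒2i≤N : ∀ i → 1 ℕ.≤ i → i ℕ.≤ N → + 0 < l i → 2 ℕ.* i ℕ.≤ N
  l-pos⇒2i≤N i 1≤i i≤N 0<li with 2 ℕ.* i ℕP.≤? N
  ... | yes 2i≤N = 2i≤N
  ... | no 2i≰N = ⊥-elim (ℤP.<-asym 0<li (begin-strict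
    l i                ≤⟨ l-antitone (suc N ∸ i) i (reflect-≥1 i≤N) reflection≤i i≤N ⟩
    l (suc N ∸ i)      ≡⟨ l-reflect i 1≤i i≤N ⟩
    - l i              <⟨ ℤP.neg-mono-< 0<li ⟩
    + 0                ∎))
    where
    open ℤP.≤-Reasoning
    reflection≤i : suc N ∸ i ℕ.≤ i
    reflection≤i = subst (suc N ∸ i ℕ.≤_) (ℕP.m+n∸m≡n i i)
      (ℕP.∸-monoˡ-≤ i (subst (suc N ℕ.≤_) (cong (i ℕ.+_) (ℕP.+-identityʳ i)) (ℕP.≰⇒> 2i≰N)))

  -- A zero entry is fixed by i ↦ N + 1 - i, since l is strictly decreasing.
  l≡0⇒Odd : ∀ i → 1 ℕ.≤ i → i ℕ.≤ N → l i ≡ + 0 → Odd N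
  l≡0⇒Odd i 1≤i i≤N li≡0 = by-position (ℕP.<-cmp i (suc N ∸ i))
    where
    li'≡0 : l (suc N ∸ i) ≡ + 0
    li'≡0 = trans (l-reflect i 1≤i i≤N) (cong -_ li≡0)
    fixed : ∀ i → 1 ℕ.≤ i → suc N ≡ i ℕ.+ i → Odd N
    fixed (suc p) _ e = subst Odd (sym (ℕP.suc-injective (trans e (ℕP.+-suc (suc p) p)))) (Odd-suc[p+p] p)
    by-position : Tri (i ℕ.< suc N ∸ i) (i ≡ suc N ∸ i) (suc N ∸ i ℕ.< i) → Odd N
    by-position (tri< i<i' _ _) = ⊥-elim (ℤP.<-irrefl (trans li'≡0 (sym li≡0))
                                     (l-strictAnti i (suc N ∸ i) 1≤i i<i' (reflect-≤ 1≤i)))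
    by-position (tri> _ _ i'<i) = ⊥-elim (ℤP.<-irrefl (trans li≡0 (sym li'≡0))
                                     (l-strictAnti (suc N ∸ i) i (reflect-≥1 i≤N) i'<i i≤N))
    by-position (tri≈ _ i≡i' _) =
      fixed i 1≤i (trans (sym (ℕP.m+[n∸m]≡n (ℕP.m≤n⇒m≤1+n i≤N))) (cong (i ℕ.+_) (sym i≡i')))

module Ties where
  open import Data.Integer using (_<_)

  All-tensor : ∀ {P : WC → Set} π σ {p q} → All P (tensor π σ) → p ∈ π → q ∈ σ → All P (p ⊗ q)
  All-tensor π σ Pτ p∈π q∈σ =
    All.lookup (Allₚ.map⁻ (Allₚ.concat⁻ (All.lookup (Allₚ.map⁻ (Allₚ.concat⁻ Pτ)) p∈π))) q∈σ

  All-⊗-tie : ∀ {P : WC → Set} x y T T' → x ≡ y → All P (two x T ⊗ two y T') →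
              P (sgn 0 (T + T')) × P (sgn 1 (T + T'))
  All-⊗-tie x y T T' x≡y Pxy with x ℤ.≟ y | Pxy
  ... | yes _  | _ ∷ P₀ ∷ P₁ ∷ [] = P₀ , P₁
  ... | no x≢y | _                 = ⊥-elim (x≢y x≡y)

  two∈piW : ∀ N w l δ i → 1 ℕ.≤ i → 2 ℕ.* i ℕ.≤ N → two (l i) (- w) ∈ piW N w l δ
  two∈piW N w l δ (suc p) _ 2i≤N = ∈-++⁺ˡ (∈-map⁺ (λ i → two (l i) (- w)) (∈-map⁺ suc (∈-upTo⁺ i≤N/2)))
    where
    i≤N/2 : suc p ℕ.≤ N ℕ./ 2
    i≤N/2 = subst (ℕ._≤ N ℕ./ 2) (ℕD.m*n/n≡m (suc p) 2)
                  (ℕD./-monoˡ-≤ 2 (subst (ℕ._≤ N) (ℕP.*-comm 2 (suc p)) 2i≤N))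

  sign-parity-cases : ∀ q → (∃ λ k → q ≡ - (+ 2 * + k)) ⊎ (∃ λ k → q ≡ - (+ 2 * + k) - + 1)
                          ⊎ (∃ λ k → q ≡ + 1 + + 2 * + k) ⊎ (∃ λ k → q ≡ + 2 + + 2 * + k)
  sign-parity-cases (+ zero) = inj₁ (0 , refl)
  sign-parity-cases (+ suc p) with even-or-odd p
  ... | h , inj₁ refl = inj₂ (inj₂ (inj₁ (h , cong (λ t → + 1 + t) (pos-double h))))
  ... | h , inj₂ refl = inj₂ (inj₂ (inj₂ (h , cong (λ t → + 2 + t) (pos-double h))))
  sign-parity-cases -[1+ p ] with even-or-odd p
  ... | h , inj₁ refl = inj₂ (inj₁ (h , trans (cong (λ t → - (+ 1 + t)) (pos-double h)) (regroup (+ h))))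
    where
    regroup : ∀ K → - (+ 1 + + 2 * K) ≡ - (+ 2 * K) - + 1
    regroup = solve-∀
  ... | h , inj₂ refl = inj₁ (suc h , cong -_ (pos-double (suc h)))

  NoPoles : ℤ → WC → Set
  NoPoles S c = ¬ LPole c S × ¬ LPole (dual c) (+ 2 - S)

  private
    four : ∀ k → - (+ 4 * + k) ≡ - + (4 ℕ.* k)
    four k = cong -_ (sym (ℤP.pos-* 4 k))

  -- With x = s + t an integer, one of x, x + 1 (from L(s, ·)) or 1 - x, 2 - x (from L(1 - s, ·̌))
  -- is an even integer ≤ 0, i.e. a pole of Γ_ℝ.
  sgn-pair-has-pole : ∀ S T q → S + T ≡ + 2 * q → NoPoles S (sgn 0 T) → NoPoles S (sgn 1 T) → ⊥
  sgn-pair-has-pole S T q S+T≡ (¬pole₀ , ¬pole₀ˇ) (¬pole₁ , ¬pole₁ˇ) with sign-parity-cases q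
  ... | inj₁ (k , refl) =
    ¬pole₀ (k , trans (ℤP.+-identityʳ _) (trans S+T≡ (trans (shape (+ k)) (four k))))
    where
    shape : ∀ K → + 2 * - (+ 2 * K) ≡ - (+ 4 * K)
    shape = solve-∀
  ... | inj₂ (inj₁ (k , refl)) =
    ¬pole₁ (k , trans (cong (_+ + 2) S+T≡) (trans (shape (+ k)) (four k)))
    where
    shape : ∀ K → + 2 * (- (+ 2 * K) - + 1) + + 2 ≡ - (+ 4 * K)
    shape = solve-∀
  ... | inj₂ (inj₂ (inj₁ (k , refl))) =
    ¬pole₀ˇ (k , trans (dual-arg S T) (trans (cong (λ t → + 2 - t) S+T≡) (trans (shape (+ k)) (four k))))
    where
    dual-arg : ∀ S T → + 2 - S + - T + + 0 ≡ + 2 - (S + T)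
    dual-arg = solve-∀
    shape : ∀ K → + 2 - + 2 * (+ 1 + + 2 * K) ≡ - (+ 4 * K)
    shape = solve-∀
  ... | inj₂ (inj₂ (inj₂ (k , refl))) =
    ¬pole₁ˇ (k , trans (dual-arg S T) (trans (cong (λ t → + 4 - t) S+T≡) (trans (shape (+ k)) (four k))))
    where
    dual-arg : ∀ S T → + 2 - S + - T + + 2 ≡ + 4 - (S + T)
    dual-arg = solve-∀
    shape : ∀ K → + 4 - + 2 * (+ 2 + + 2 * K) ≡ - (+ 4 * K)
    shape = solve-∀

  -- The parities of w + lᵢ and w' + l'ⱼ make s + t an integer when lᵢ = l'ⱼ.
  tie⇒sum-even : ∀ w w' x k₀ k k' n m → w + x ≡ + 1 + n + + 2 * k → w' + x ≡ + 1 + m + + 2 * k' →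
                 (n + m + + 2 * k₀) + (- w + - w') ≡ + 2 * (k₀ - k - k' + x - + 1)
  tie⇒sum-even w w' x k₀ k k' n m wx≡ w'x≡ = begin
    (n + m + + 2 * k₀) + (- w + - w')                           ≡⟨ expand w w' x k₀ n m ⟩
    n + m + + 2 * k₀ - (w + x) - (w' + x) + + 2 * x             ≡⟨ cong₂ (λ a b → n + m + + 2 * k₀ - a - b + + 2 * x) wx≡ w'x≡ ⟩
    n + m + + 2 * k₀ - (+ 1 + n + + 2 * k) - (+ 1 + m + + 2 * k') + + 2 * x ≡⟨ collect x k₀ k k' n m ⟩
    + 2 * (k₀ - k - k' + x - + 1)                               ∎
    where
    open ≡-Reasoning
    expand : ∀ w w' x k₀ n m → (n + m + + 2 * k₀) + (- w + - w') ≡ n + m + + 2 * k₀ - (w + x) - (w' + x) + + 2 * x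
    expand = solve-∀
    collect : ∀ x k₀ k k' n m → n + m + + 2 * k₀ - (+ 1 + n + + 2 * k) - (+ 1 + m + + 2 * k') + + 2 * x
                                ≡ + 2 * (k₀ - k - k' + x - + 1)
    collect = solve-∀

  module _ {n m w l w' l'} (hl : InL0+ n w l) (hl' : InL0+ m w' l') {δ δ' : ℕ} {S : ℤ}
           (critical : Critical n m (tensor (piW n w l δ) (piW m w' l' δ')) S) where
    private
      module Wn = Weight hl
      module Wm = Weight hl'

    no-tie-in-first-half : ∀ i j → 1 ℕ.≤ i → 2 ℕ.* i ℕ.≤ n → 1 ℕ.≤ j → 2 ℕ.* j ℕ.≤ m → l i ≢ l' j
    no-tie-in-first-half i j 1≤i 2i≤n 1≤j 2j≤m li≡l'j
      with All-⊗-tie (l i) (l' j) (- w) (- w') li≡l'j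
             (All-tensor (piW n w l δ) (piW m w' l' δ') (proj₂ critical)
                         (two∈piW n w l δ i 1≤i 2i≤n) (two∈piW m w' l' δ' j 1≤j 2j≤m))
    ... | P₀ , P₁ with proj₁ critical | InL0+.parity hl i 1≤i (ℕP.≤-trans (ℕP.m≤n*m i 2) 2i≤n)
                     | InL0+.parity hl' j 1≤j (ℕP.≤-trans (ℕP.m≤n*m j 2) 2j≤m)
    ... | k₀ , refl | k , wli | k' , w'l'j =
      sgn-pair-has-pole (+ (n ℕ.+ m) + + 2 * k₀) (- w + - w') _
        (tie⇒sum-even w w' (l i) k₀ k k' (+ n) (+ m) wli (trans (cong (λ t → w' + t) li≡l'j) w'l'j)) P₀ P₁

    critical⇒l≢l' : ¬ (Odd n × Odd m) → ∀ i j → 1 ℕ.≤ i → i ℕ.≤ n → 1 ℕ.≤ j → j ℕ.≤ m → l i ≢ l' j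
    critical⇒l≢l' not-both-odd i j 1≤i i≤n 1≤j j≤m li≡l'j = by-sign (ℤP.<-cmp (+ 0) (l i))
      where
      by-sign : Tri (+ 0 < l i) (+ 0 ≡ l i) (l i < + 0) → ⊥
      by-sign (tri< 0<li _ _) =
        no-tie-in-first-half i j 1≤i (Wn.l-pos⇒2i≤N i 1≤i i≤n 0<li)
          1≤j (Wm.l-pos⇒2i≤N j 1≤j j≤m (subst (+ 0 <_) li≡l'j 0<li)) li≡l'j
      by-sign (tri≈ _ 0≡li _) =
        not-both-odd (Wn.l≡0⇒Odd i 1≤i i≤n (sym 0≡li) , Wm.l≡0⇒Odd j 1≤j j≤m (trans (sym li≡l'j) (sym 0≡li)))
      by-sign (tri> _ _ li<0) =
        no-tie-in-first-half (suc n ∸ i) (suc m ∸ j)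
          (reflect-≥1 i≤n) (Wn.l-pos⇒2i≤N _ (reflect-≥1 i≤n) (reflect-≤ 1≤i) 0<li')
          (reflect-≥1 j≤m) (Wm.l-pos⇒2i≤N _ (reflect-≥1 j≤m) (reflect-≤ 1≤j) (subst (+ 0 <_) reflected-tie 0<li'))
          reflected-tie
        where
        0<li' : + 0 < l (suc n ∸ i)
        0<li' = subst (+ 0 <_) (sym (Wn.l-reflect i 1≤i i≤n)) (ℤP.neg-mono-< li<0)
        reflected-tie : l (suc n ∸ i) ≡ l' (suc m ∸ j)
        reflected-tie = trans (Wn.l-reflect i 1≤i i≤n) (trans (cong -_ li≡l'j) (sym (Wm.l-reflect j 1≤j j≤m)))

open Ties

module Bracket where
  open import Data.Integer using (_≤_; _<_)

  bracket : (l : ℕ → ℤ) → ∀ x k → x < l 1 → l (suc k) ≤ x →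
            ∃ λ a → 1 ℕ.≤ a × a ℕ.≤ k × x < l a × l (suc a) ≤ x
  bracket l x zero x<l₁ l₁≤x = ⊥-elim (ℤP.<-irrefl refl (ℤP.<-≤-trans x<l₁ l₁≤x))
  bracket l x (suc k) x<l₁ lk+2≤x with l (suc k) ℤP.≤? x
  ... | yes lk+1≤x with bracket l x k x<l₁ lk+1≤x
  ...   | a , 1≤a , a≤k , x<la , la+1≤x = a , 1≤a , ℕP.m≤n⇒m≤1+n a≤k , x<la , la+1≤x
  bracket l x (suc k) x<l₁ lk+2≤x | no lk+1≰x = suc k , s≤s z≤n , ℕP.≤-refl , ℤP.≰⇒> lk+1≰x , lk+2≤x

  module _ {N w l} (hl : InL0+ N w l) where
    open Weight hl

    bracket-unique : ∀ x b c → 1 ℕ.≤ b → 1 ℕ.≤ c → b ℕ.< N → c ℕ.< N →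
                     x < l b → l (suc b) ≤ x → x < l c → l (suc c) ≤ x → b ≡ c
    bracket-unique x b c 1≤b 1≤c b<N c<N x<lb lb+1≤x x<lc lc+1≤x with ℕP.<-cmp b c
    ... | tri≈ _ b≡c _ = b≡c
    ... | tri< b<c _ _ = ⊥-elim (ℤP.<-irrefl refl
          (ℤP.≤-<-trans (ℤP.≤-trans (l-antitone (suc b) c (s≤s z≤n) b<c (ℕP.<⇒≤ c<N)) lb+1≤x) x<lc))
    ... | tri> _ _ c<b = ⊥-elim (ℤP.<-irrefl refl
          (ℤP.≤-<-trans (ℤP.≤-trans (l-antitone (suc c) b (s≤s z≤n) c<b (ℕP.<⇒≤ b<N)) lc+1≤x) x<lb))

open Bracket

module Existence {n m w l w' l'} (1≤n : 1 ℕ.≤ n) (1≤m : 1 ℕ.≤ m) (hl : InL0+ n w l) (hl' : InL0+ m w' l')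
                 (l'₁<l₁ : l' 1 ℤ.< l 1) where
  open import Data.Integer using (_≤_; _<_)
  private
    module Wn = Weight hl
    module Wm = Weight hl'

  positionTuple : ℕ → ℕ
  positionTuple j with l' j ℤP.<? l 1 | l (suc (n ∸ 1)) ℤP.≤? l' j
  ... | yes l'j<l₁ | yes lₙ≤l'j = proj₁ (bracket l (l' j) (n ∸ 1) l'j<l₁ lₙ≤l'j)
  ... | _          | _          = 0

  l'<l₁ : ∀ j → 1 ℕ.≤ j → j ℕ.≤ m → l' j < l 1
  l'<l₁ j 1≤j j≤m = ℤP.≤-<-trans (Wm.l-antitone 1 j ℕP.≤-refl 1≤j j≤m) l'₁<l₁

  lₙ≤l' : ∀ j → 1 ℕ.≤ j → j ℕ.≤ m → l (suc (n ∸ 1)) ≤ l' j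
  lₙ≤l' j 1≤j j≤m = ℤP.<⇒≤ (begin-strict
    l (suc (n ∸ 1))    ≡⟨ cong l (ℕP.m+[n∸m]≡n 1≤n) ⟩
    l (suc n ∸ 1)      ≡⟨ Wn.l-reflect 1 ℕP.≤-refl 1≤n ⟩
    - l 1              <⟨ ℤP.neg-mono-< l'₁<l₁ ⟩
    - l' 1             ≡⟨ Wm.l-reflect 1 ℕP.≤-refl 1≤m ⟨
    l' (suc m ∸ 1)     ≤⟨ Wm.l-antitone j m 1≤j j≤m ℕP.≤-refl ⟩
    l' j               ∎)
    where open ℤP.≤-Reasoning

  positionTuple-isPosTuple : IsPosTuple n m l l' positionTuple
  positionTuple-isPosTuple j 1≤j j≤m with l' j ℤP.<? l 1 | l (suc (n ∸ 1)) ℤP.≤? l' j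
  ... | yes l'j<l₁ | yes lₙ≤l'j = proj₂ (bracket l (l' j) (n ∸ 1) l'j<l₁ lₙ≤l'j)
  ... | no l'j≮l₁  | _          = ⊥-elim (l'j≮l₁ (l'<l₁ j 1≤j j≤m))
  ... | yes _      | no lₙ≰l'j  = ⊥-elim (lₙ≰l'j (lₙ≤l' j 1≤j j≤m))

module Positions {n m w l w' l'} (1≤n : 1 ℕ.≤ n) (hl : InL0+ n w l) (hl' : InL0+ m w' l')
                 {a : ℕ → ℕ} (pa : IsPosTuple n m l l' a)
                 (l≢l' : ∀ i j → 1 ℕ.≤ i → i ℕ.≤ n → 1 ℕ.≤ j → j ℕ.≤ m → l i ≢ l' j) where
  open import Data.Integer using (_≤_; _<_)
  private
    module Wn = Weight hl
    module Wm = Weight hl'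

  1≤a : ∀ j → 1 ℕ.≤ j → j ℕ.≤ m → 1 ℕ.≤ a j
  1≤a j 1≤j j≤m = proj₁ (pa j 1≤j j≤m)

  a<n : ∀ j → 1 ℕ.≤ j → j ℕ.≤ m → a j ℕ.< n
  a<n j 1≤j j≤m = subst (suc (a j) ℕ.≤_) (ℕP.m+[n∸m]≡n 1≤n) (s≤s (proj₁ (proj₂ (pa j 1≤j j≤m))))

  a≤n : ∀ j → 1 ℕ.≤ j → j ℕ.≤ m → a j ℕ.≤ n
  a≤n j 1≤j j≤m = ℕP.<⇒≤ (a<n j 1≤j j≤m)

  l'<l∘a : ∀ j → 1 ℕ.≤ j → j ℕ.≤ m → l' j < l (a j)
  l'<l∘a j 1≤j j≤m = proj₁ (proj₂ (proj₂ (pa j 1≤j j≤m)))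

  l∘suc∘a≤l' : ∀ j → 1 ℕ.≤ j → j ℕ.≤ m → l (suc (a j)) ≤ l' j
  l∘suc∘a≤l' j 1≤j j≤m = proj₂ (proj₂ (proj₂ (pa j 1≤j j≤m)))

  l∘suc∘a<l' : ∀ j → 1 ℕ.≤ j → j ℕ.≤ m → l (suc (a j)) < l' j
  l∘suc∘a<l' j 1≤j j≤m = ℤP.≤∧≢⇒< (l∘suc∘a≤l' j 1≤j j≤m) (l≢l' (suc (a j)) j (s≤s z≤n) (a<n j 1≤j j≤m) 1≤j j≤m)

  a-step : ∀ j → 1 ℕ.≤ j → j ℕ.< m → a j ℕ.≤ a (suc j)
  a-step j 1≤j j<m with a j ℕP.≤? a (suc j)
  ... | yes aj≤aj+1 = aj≤aj+1
  ... | no aj≰aj+1 = ⊥-elim (ℤP.<-asym (l'<l∘a j 1≤j (ℕP.<⇒≤ j<m)) (begin-strict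
    l (a j)              ≤⟨ Wn.l-antitone (suc (a (suc j))) (a j) (s≤s z≤n) (ℕP.≰⇒> aj≰aj+1) (a≤n j 1≤j (ℕP.<⇒≤ j<m)) ⟩
    l (suc (a (suc j)))  ≤⟨ l∘suc∘a≤l' (suc j) (ℕP.m≤n⇒m≤1+n 1≤j) j<m ⟩
    l' (suc j)           <⟨ InL0+.decr hl' j 1≤j j<m ⟩
    l' j                 ∎))
    where open ℤP.≤-Reasoning

  a-monotone : ∀ j j' → 1 ℕ.≤ j → j ℕ.≤ j' → j' ℕ.≤ m → a j ℕ.≤ a j'
  a-monotone j j' 1≤j j≤j' j'≤m =
    subst (λ t → a j ℕ.≤ a t) (ℕP.m∸n+n≡m j≤j') (go (j' ∸ j) (subst (ℕ._≤ m) (sym (ℕP.m∸n+n≡m j≤j')) j'≤m))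
    where
    go : ∀ d → d ℕ.+ j ℕ.≤ m → a j ℕ.≤ a (d ℕ.+ j)
    go zero    _       = ℕP.≤-refl
    go (suc d) d+j<m = ℕP.≤-trans (go d (ℕP.<⇒≤ d+j<m)) (a-step (d ℕ.+ j) (ℕP.≤-trans 1≤j (ℕP.m≤n+m j d)) d+j<m)

  -- Negating l_{a_j} > l'_j > l_{1+a_j} brackets l'_{m+1-j} = -l'_j between l_{n-a_j} and l_{n+1-a_j};
  -- the second inequality is strict only because there are no ties.
  a-reflect : ∀ j → 1 ℕ.≤ j → j ℕ.≤ m → a (suc m ∸ j) ≡ n ∸ a j
  a-reflect j 1≤j j≤m =
    bracket-unique hl (l' j') (a j') (n ∸ a j) (1≤a j' 1≤j' j'≤m) (ℕP.m<n⇒0<n∸m (a<n j 1≤j j≤m))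
                   (a<n j' 1≤j' j'≤m) n-aj<n
                   (l'<l∘a j' 1≤j' j'≤m) (l∘suc∘a≤l' j' 1≤j' j'≤m) l'j'<l[n-aj] l[n-aj+1]≤l'j'
    where
    j' = suc m ∸ j
    1≤j' = reflect-≥1 j≤m
    j'≤m = reflect-≤ 1≤j
    l'j'≡ : l' j' ≡ - l' j
    l'j'≡ = Wm.l-reflect j 1≤j j≤m
    n-aj<n : suc (n ∸ a j) ℕ.≤ n
    n-aj<n = subst (suc (n ∸ a j) ℕ.≤_) (ℕP.m+[n∸m]≡n 1≤n) (s≤s (ℕP.∸-monoʳ-≤ n (1≤a j 1≤j j≤m)))
    l'j'<l[n-aj] : l' j' < l (n ∸ a j)
    l'j'<l[n-aj] = subst₂ _<_ (sym l'j'≡) (sym (Wn.l-reflect (suc (a j)) (s≤s z≤n) (a<n j 1≤j j≤m)))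
                          (ℤP.neg-mono-< (l∘suc∘a<l' j 1≤j j≤m))
    l[n-aj+1]≤l'j' : l (suc (n ∸ a j)) ≤ l' j'
    l[n-aj+1]≤l'j' = subst₂ _≤_
      (sym (trans (cong l (sym (ℕP.+-∸-assoc 1 (a≤n j 1≤j j≤m)))) (Wn.l-reflect (a j) (1≤a j 1≤j j≤m) (a≤n j 1≤j j≤m))))
      (sym l'j'≡) (ℤP.<⇒≤ (ℤP.neg-mono-< (l'<l∘a j 1≤j j≤m)))

  2*lam : ∀ j → 1 ℕ.≤ j → j ℕ.≤ m → + 2 * lam m w' l' a j ≡ w' + l' j - + 1 - + m + + 2 * + a j
  2*lam j 1≤j j≤m = begin
    + 2 * (mu m w' l' j + + a j - + j)                        ≡⟨ distrib (mu m w' l' j) (+ a j) (+ j) ⟩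
    + 2 * mu m w' l' j + + 2 * + a j - + 2 * + j              ≡⟨ cong (λ t → t + + 2 * + a j - + 2 * + j) (Wm.2*mu j 1≤j j≤m) ⟩
    w' + l' j + + 2 * + j - + 1 - + m + + 2 * + a j - + 2 * + j ≡⟨ cancel w' (l' j) (+ j) (+ m) (+ a j) ⟩
    w' + l' j - + 1 - + m + + 2 * + a j                       ∎
    where
    open ≡-Reasoning
    distrib : ∀ M A J → + 2 * (M + A - J) ≡ + 2 * M + + 2 * A - + 2 * J
    distrib = solve-∀
    cancel : ∀ w lj J m A → w + lj + + 2 * J - + 1 - m + + 2 * A - + 2 * J ≡ w + lj - + 1 - m + + 2 * A
    cancel = solve-∀

  -- 2λⱼ = l'ⱼ + 2aⱼ + const: a jump of a from aⱼ to aⱼ₊₁ passes l-entries spaced ≥ 2 apart between l'ⱼ and l'ⱼ₊₁.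
  l'+2a-step : ∀ j → 1 ℕ.≤ j → j ℕ.< m → l' (suc j) + + 2 * + a (suc j) ≼ l' j + + 2 * + a j
  l'+2a-step j 1≤j j<m with ℕP.m≤n⇒m<n∨m≡n (a-step j 1≤j j<m)
  ... | inj₂ aj≡aj+1 with <⇒1+≼ (InL0+.decr hl' j 1≤j j<m)
  ...   | s , l'j≡ = suc s , trans (cong (λ t → t + + 2 * + a j) l'j≡)
          (trans (cong (λ t → l' (suc j) + + 1 + + s + + 2 * + t) aj≡aj+1) (regroup (l' (suc j)) (+ s) (+ a (suc j))))
    where
    regroup : ∀ L S A → L + + 1 + S + + 2 * A ≡ L + + 2 * A + (+ 1 + S)
    regroup = solve-∀
  l'+2a-step j 1≤j j<m | inj₁ aj<aj+1
    with <⇒1+≼ (l∘suc∘a<l' j 1≤j (ℕP.<⇒≤ j<m))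
       | Wn.l-gap (suc (a j)) (a (suc j)) (s≤s z≤n) aj<aj+1 (a≤n (suc j) (ℕP.m≤n⇒m≤1+n 1≤j) j<m)
       | <⇒1+≼ (l'<l∘a (suc j) (ℕP.m≤n⇒m≤1+n 1≤j) j<m)
  ... | s₁ , l'j≡ | s , l∘suc∘aj≡ | s₂ , l∘aj+1≡ =
    s ℕ.+ s₁ ℕ.+ s₂ , chain (l' j) _ _ (l' (suc j)) (+ a j) (+ a (suc j)) (+ s) (+ s₁) (+ s₂)
                        l'j≡ (trans l∘suc∘aj≡ (cong (λ t → l (a (suc j)) + + 2 * t + + s) (pos-∸ aj<aj+1))) l∘aj+1≡
    where
    chain : ∀ L'j la lb L'j+1 A B S S₁ S₂ → L'j ≡ la + + 1 + S₁ → la ≡ lb + + 2 * (B - (+ 1 + A)) + S →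
            lb ≡ L'j+1 + + 1 + S₂ → L'j + + 2 * A ≡ L'j+1 + + 2 * B + (S + S₁ + S₂)
    chain _ _ _ L'j+1 A B S S₁ S₂ refl refl refl = regroup L'j+1 A B S S₁ S₂
      where
      regroup : ∀ L A B S S₁ S₂ → L + + 1 + S₂ + + 2 * (B - (+ 1 + A)) + S + + 1 + S₁ + + 2 * A
                                  ≡ L + + 2 * B + (S + S₁ + S₂)
      regroup = solve-∀

  lam-step : ∀ j → 1 ℕ.≤ j → j ℕ.< m → lam m w' l' a (suc j) ≤ lam m w' l' a j
  lam-step j 1≤j j<m with l'+2a-step j 1≤j j<m
  ... | s , e = 2*≼2*⇒≤ (s , (begin
    + 2 * lam m w' l' a j                             ≡⟨ 2*lam j 1≤j (ℕP.<⇒≤ j<m) ⟩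
    w' + l' j - + 1 - + m + + 2 * + a j               ≡⟨ split w' (+ m) (l' j) (+ a j) ⟩
    w' - + 1 - + m + (l' j + + 2 * + a j)             ≡⟨ cong (λ t → w' - + 1 - + m + t) e ⟩
    w' - + 1 - + m + (l' (suc j) + + 2 * + a (suc j) + + s) ≡⟨ unsplit w' (+ m) (l' (suc j)) (+ a (suc j)) (+ s) ⟩
    w' + l' (suc j) - + 1 - + m + + 2 * + a (suc j) + + s ≡⟨ cong (_+ + s) (2*lam (suc j) (ℕP.m≤n⇒m≤1+n 1≤j) j<m) ⟨
    + 2 * lam m w' l' a (suc j) + + s                 ∎))
    where
    open ≡-Reasoning
    split : ∀ w m L A → w + L - + 1 - m + + 2 * A ≡ w - + 1 - m + (L + + 2 * A)
    split = solve-∀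
    unsplit : ∀ w m L A S → w - + 1 - m + (L + + 2 * A + S) ≡ w + L - + 1 - m + + 2 * A + S
    unsplit = solve-∀

  lam-antitone : ∀ j j' → 1 ℕ.≤ j → j ℕ.≤ j' → j' ℕ.≤ m → lam m w' l' a j' ≤ lam m w' l' a j
  lam-antitone j j' 1≤j j≤j' j'≤m =
    subst (λ t → lam m w' l' a t ≤ lam m w' l' a j) (ℕP.m∸n+n≡m j≤j')
          (go (j' ∸ j) (subst (ℕ._≤ m) (sym (ℕP.m∸n+n≡m j≤j')) j'≤m))
    where
    go : ∀ d → d ℕ.+ j ℕ.≤ m → lam m w' l' a (d ℕ.+ j) ≤ lam m w' l' a j
    go zero    _     = ℤP.≤-refl
    go (suc d) d+j<m = ℤP.≤-trans (lam-step (d ℕ.+ j) (ℕP.≤-trans 1≤j (ℕP.m≤n+m j d)) d+j<m) (go d (ℕP.<⇒≤ d+j<m))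

  lam-reflect : ∀ j → 1 ℕ.≤ j → j ℕ.≤ m → lam m w' l' a j + lam m w' l' a (suc m ∸ j) ≡ w' + + n - + m - + 1
  lam-reflect j 1≤j j≤m = 2*-injective (begin
    + 2 * (lam m w' l' a j + lam m w' l' a j')
      ≡⟨ distrib (lam m w' l' a j) (lam m w' l' a j') ⟩
    + 2 * lam m w' l' a j + + 2 * lam m w' l' a j'
      ≡⟨ cong₂ _+_ (2*lam j 1≤j j≤m) (2*lam j' (reflect-≥1 j≤m) (reflect-≤ 1≤j)) ⟩
    (w' + l' j - + 1 - + m + + 2 * + a j) + (w' + l' j' - + 1 - + m + + 2 * + a j')
      ≡⟨ cong₂ (λ x y → (w' + l' j - + 1 - + m + + 2 * + a j) + (w' + x - + 1 - + m + + 2 * y))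
               (Wm.l-reflect j 1≤j j≤m) (trans (cong +_ (a-reflect j 1≤j j≤m)) (pos-∸ (a≤n j 1≤j j≤m))) ⟩
    (w' + l' j - + 1 - + m + + 2 * + a j) + (w' + - l' j - + 1 - + m + + 2 * (+ n - + a j))
      ≡⟨ collect w' (l' j) (+ a j) (+ n) (+ m) ⟩
    + 2 * (w' + + n - + m - + 1)                                 ∎)
    where
    open ≡-Reasoning
    j' = suc m ∸ j
    distrib : ∀ a b → + 2 * (a + b) ≡ + 2 * a + + 2 * b
    distrib = solve-∀
    collect : ∀ w lj A n m → (w + lj - + 1 - m + + 2 * A) + (w + - lj - + 1 - m + + 2 * (n - A))
                            ≡ + 2 * (w + n - m - + 1)
    collect = solve-∀

module NthElement where
  open import Data.Nat using (_≤_; _<_)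

  nth-∈ : ∀ xs i → i < length xs → nth xs i ∈ xs
  nth-∈ (x ∷ xs) zero    _         = here refl
  nth-∈ (x ∷ xs) (suc i) (s≤s i<n) = there (nth-∈ xs i i<n)

  ∈⇒nth : ∀ {xs x} → x ∈ xs → ∃ λ i → i < length xs × nth xs i ≡ x
  ∈⇒nth (here refl) = 0 , s≤s z≤n , refl
  ∈⇒nth (there x∈xs) with ∈⇒nth x∈xs
  ... | i , i<n , xs[i]≡x = suc i , s≤s i<n , xs[i]≡x

  nth-strictMono : ∀ {xs} → AllPairs _<_ xs → ∀ {i j} → i < j → j < length xs → nth xs i < nth xs j
  nth-strictMono {x ∷ xs} (x< ∷ _) {zero} {suc j} _ (s≤s j<n) = All.lookup x< (nth-∈ xs j j<n)
  nth-strictMono (_ ∷ sorted) {suc i} {suc j} (s≤s i<j) (s≤s j<n) = nth-strictMono sorted i<j j<n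

  nth-∷ʳ : ∀ xs y → nth (xs ++ [ y ]) (length xs) ≡ y
  nth-∷ʳ []       y = refl
  nth-∷ʳ (x ∷ xs) y = nth-∷ʳ xs y

open NthElement

module Enumeration where
  open import Data.Nat using (_≤_; _<_)

  StrictMonoUpTo : ℕ → (ℕ → ℕ) → Set
  StrictMonoUpTo r f = ∀ i j → i < j → j ≤ r → f i < f j

  ImageWithin : ℕ → (ℕ → ℕ) → (ℕ → ℕ) → Set
  ImageWithin r f g = ∀ i → i ≤ r → ∃ λ σ → σ ≤ r × g σ ≡ f i

  private
    -- If f, g agree below i and f i is a value g σ, then σ < i is impossible and σ > i gives g i < f i.
    ≤-at : ∀ {r f g} → StrictMonoUpTo r f → StrictMonoUpTo r g → ImageWithin r f g →
           ∀ i → i ≤ r → (∀ k → k < i → f k ≡ g k) → g i ≤ f i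
    ≤-at {r} {f} {g} f-inc g-inc f⊆g i i≤r agree with f⊆g i i≤r
    ... | σ , σ≤r , gσ≡fi with ℕP.<-cmp σ i
    ... | tri< σ<i _ _ = ⊥-elim (ℕP.<-irrefl (trans (agree σ σ<i) gσ≡fi) (f-inc σ i σ<i i≤r))
    ... | tri≈ _ refl _ = ℕP.≤-reflexive gσ≡fi
    ... | tri> _ _ i<σ = subst (g i ≤_) gσ≡fi (ℕP.<⇒≤ (g-inc i σ i<σ σ≤r))

  enumerations-agree : ∀ {r f g} → StrictMonoUpTo r f → StrictMonoUpTo r g →
                       ImageWithin r f g → ImageWithin r g f → ∀ i → i ≤ r → f i ≡ g i
  enumerations-agree {r} {f} {g} f-inc g-inc f⊆g g⊆f i i≤r = agree-below (suc i) i ℕP.≤-refl i≤r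
    where
    agree-below : ∀ i k → k < i → k ≤ r → f k ≡ g k
    agree-below (suc i) k k<1+i k≤r with ℕP.m≤n⇒m<n∨m≡n (ℕP.≤-pred k<1+i)
    ... | inj₁ k<i  = agree-below i k k<i k≤r
    ... | inj₂ refl = ℕP.≤-antisym
      (≤-at g-inc f-inc g⊆f k k≤r (λ k' k'<k → sym (agree-below k k' k'<k (ℕP.≤-trans (ℕP.<⇒≤ k'<k) k≤r))))
      (≤-at f-inc g-inc f⊆g k k≤r (λ k' k'<k → agree-below k k' k'<k (ℕP.≤-trans (ℕP.<⇒≤ k'<k) k≤r)))

open Enumeration

module JumpIndices {n m} (1≤m : 1 ℕ.≤ m) {a : ℕ → ℕ}
                   (a-monotone : ∀ j j' → 1 ℕ.≤ j → j ℕ.≤ j' → j' ℕ.≤ m → a j ℕ.≤ a j')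
                   (a-reflect : ∀ j → 1 ℕ.≤ j → j ℕ.≤ m → a (suc m ∸ j) ≡ n ∸ a j)
                   (a≤n : ∀ j → 1 ℕ.≤ j → j ℕ.≤ m → a j ℕ.≤ n) where
  open import Data.Nat using (_≤_; _<_)

  r : ℕ
  r = rr m a

  J : ℕ → ℕ
  J = jAt m a

  IsJump : ℕ → Set
  IsJump j = 1 ≤ j × j ≤ m ∸ 1 × a j < a (suc j)

  js : List ℕ
  js = 0 ∷ jumps m a ++ [ m ]

  private
    range1≡ : ∀ k → range1 k ≡ applyUpTo suc k
    range1≡ k = Listₚ.map-applyUpTo (λ i → i) suc k

    m∸1<m : m ∸ 1 < m
    m∸1<m = subst (m ∸ 1 <_) (ℕP.m+[n∸m]≡n 1≤m) ℕP.≤-refl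

    ∈jumps⇒IsJump : ∀ {x} → x ∈ jumps m a → IsJump x
    ∈jumps⇒IsJump x∈ with ∈-filter⁻ (λ j → a j <? a (suc j)) {xs = range1 (m ∸ 1)} x∈
    ... | x∈range , jump with ∈-applyUpTo⁻ suc (subst (_ ∈_) (range1≡ (m ∸ 1)) x∈range)
    ...   | i , i<m-1 , refl = s≤s z≤n , i<m-1 , jump

    IsJump⇒∈jumps : ∀ {x} → IsJump x → x ∈ jumps m a
    IsJump⇒∈jumps {suc i} (_ , x≤m-1 , jump) =
      ∈-filter⁺ (λ j → a j <? a (suc j)) (subst (_ ∈_) (sym (range1≡ (m ∸ 1))) (∈-applyUpTo⁺ suc x≤m-1)) jump

  ∈js⇒ : ∀ {x} → x ∈ js → x ≡ 0 ⊎ x ≡ m ⊎ IsJump x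
  ∈js⇒ (here refl) = inj₁ refl
  ∈js⇒ (there x∈) with ∈-++⁻ (jumps m a) x∈
  ... | inj₁ x∈jumps     = inj₂ (inj₂ (∈jumps⇒IsJump x∈jumps))
  ... | inj₂ (here refl) = inj₂ (inj₁ refl)

  0∈js : 0 ∈ js
  0∈js = here refl

  m∈js : m ∈ js
  m∈js = there (∈-++⁺ʳ (jumps m a) (here refl))

  IsJump⇒∈js : ∀ {x} → IsJump x → x ∈ js
  IsJump⇒∈js jump = there (∈-++⁺ˡ (IsJump⇒∈jumps jump))

  js-increasing : AllPairs _<_ js
  js-increasing =
    Allₚ.++⁺ (All.tabulate (λ x∈ → proj₁ (∈jumps⇒IsJump x∈))) (1≤m ∷ []) ∷
    AllPairsₚ.++⁺ (AllPairsₚ.filter⁺ (λ j → a j <? a (suc j))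
                    (subst (AllPairs _<_) (sym (range1≡ (m ∸ 1))) (AllPairsₚ.applyUpTo⁺₁ suc (m ∸ 1) (λ i<j _ → s≤s i<j))))
                  ([] ∷ [])
                  (All.tabulate (λ x∈ → ℕP.≤-<-trans (proj₁ (proj₂ (∈jumps⇒IsJump x∈))) m∸1<m ∷ []))

  length-js : length js ≡ suc r
  length-js = cong suc (trans (Listₚ.length-++ (jumps m a)) (ℕP.+-comm _ 1))

  private
    ρ<length : ∀ {ρ} → ρ ≤ r → ρ < length js
    ρ<length {ρ} ρ≤r = subst (ρ <_) (sym length-js) (s≤s ρ≤r)

  J-last : J r ≡ m
  J-last = nth-∷ʳ (0 ∷ jumps m a) m

  J-strictMono : StrictMonoUpTo r J
  J-strictMono ρ ρ' ρ<ρ' ρ'≤r = nth-strictMono js-increasing ρ<ρ' (ρ<length ρ'≤r)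

  J-monotone : ∀ ρ ρ' → ρ ≤ ρ' → ρ' ≤ r → J ρ ≤ J ρ'
  J-monotone ρ ρ' ρ≤ρ' ρ'≤r with ℕP.m≤n⇒m<n∨m≡n ρ≤ρ'
  ... | inj₁ ρ<ρ' = ℕP.<⇒≤ (J-strictMono ρ ρ' ρ<ρ' ρ'≤r)
  ... | inj₂ refl = ℕP.≤-refl

  J-≤m : ∀ ρ → ρ ≤ r → J ρ ≤ m
  J-≤m ρ ρ≤r = subst (J ρ ≤_) J-last (J-monotone ρ r ρ≤r ℕP.≤-refl)

  J-≥1 : ∀ ρ → 1 ≤ ρ → ρ ≤ r → 1 ≤ J ρ
  J-≥1 ρ 1≤ρ ρ≤r = J-strictMono 0 ρ 1≤ρ ρ≤r

  J∈js : ∀ ρ → ρ ≤ r → J ρ ∈ js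
  J∈js ρ ρ≤r = nth-∈ js ρ (ρ<length ρ≤r)

  ∈js⇒J : ∀ {x} → x ∈ js → ∃ λ ρ → ρ ≤ r × J ρ ≡ x
  ∈js⇒J x∈ with ∈⇒nth x∈
  ... | ρ , ρ<length , J≡ = ρ , ℕP.≤-pred (subst (ρ <_) length-js ρ<length) , J≡

  J-jump : ∀ ρ → 1 ≤ ρ → ρ < r → a (J ρ) < a (suc (J ρ))
  J-jump ρ 1≤ρ ρ<r with ∈js⇒ (J∈js ρ (ℕP.<⇒≤ ρ<r))
  ... | inj₁ J≡0            = ⊥-elim (ℕP.<-irrefl (sym J≡0) (J-≥1 ρ 1≤ρ (ℕP.<⇒≤ ρ<r)))
  ... | inj₂ (inj₁ J≡m)     = ⊥-elim (ℕP.<-irrefl (trans J≡m (sym J-last)) (J-strictMono ρ r ρ<r ℕP.≤-refl))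
  ... | inj₂ (inj₂ (_ , _ , jump)) = jump

  -- By the symmetry of a, x ↦ m - x maps jumps to jumps.
  ∈js⇒m∸∈js : ∀ {x} → x ∈ js → m ∸ x ∈ js
  ∈js⇒m∸∈js {x} x∈ with ∈js⇒ x∈
  ... | inj₁ refl = m∈js
  ... | inj₂ (inj₁ refl) = subst (_∈ js) (sym (ℕP.n∸n≡0 m)) 0∈js
  ... | inj₂ (inj₂ (1≤x , x≤m-1 , jump)) =
    IsJump⇒∈js (ℕP.m<n⇒0<n∸m x<m , ℕP.∸-monoʳ-≤ m 1≤x ,
                subst₂ _<_ (sym a[m-x]≡) (sym a[m-x+1]≡) (ℕP.∸-monoʳ-< jump (a≤n (suc x) (s≤s z≤n) x<m)))
    where
    x<m : x < m
    x<m = ℕP.≤-<-trans x≤m-1 m∸1<m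
    a[m-x]≡ : a (m ∸ x) ≡ n ∸ a (suc x)
    a[m-x]≡ = a-reflect (suc x) (s≤s z≤n) x<m
    a[m-x+1]≡ : a (suc (m ∸ x)) ≡ n ∸ a x
    a[m-x+1]≡ = trans (cong a (sym (ℕP.+-∸-assoc 1 (ℕP.<⇒≤ x<m)))) (a-reflect x 1≤x (ℕP.<⇒≤ x<m))

  -- ρ ↦ m - J (r - ρ) is a second increasing enumeration of js.
  J-reflect : ∀ ρ → ρ ≤ r → J (r ∸ ρ) ≡ m ∸ J ρ
  J-reflect ρ ρ≤r = trans (J≡J′ (r ∸ ρ) (ℕP.m∸n≤m r ρ)) (cong (λ t → m ∸ J t) (ℕP.m∸[m∸n]≡n ρ≤r))
    where
    J′ : ℕ → ℕ
    J′ ρ = m ∸ J (r ∸ ρ)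
    J′-strictMono : StrictMonoUpTo r J′
    J′-strictMono i j i<j j≤r =
      ℕP.∸-monoʳ-< (J-strictMono (r ∸ j) (r ∸ i) (ℕP.∸-monoʳ-< i<j j≤r) (ℕP.m∸n≤m r i)) (J-≤m (r ∸ i) (ℕP.m∸n≤m r i))
    J⊆J′ : ImageWithin r J J′
    J⊆J′ i i≤r with ∈js⇒J (∈js⇒m∸∈js (J∈js i i≤r))
    ... | τ , τ≤r , Jτ≡ = r ∸ τ , ℕP.m∸n≤m r τ ,
      trans (cong (λ t → m ∸ J t) (ℕP.m∸[m∸n]≡n τ≤r)) (trans (cong (m ∸_) Jτ≡) (ℕP.m∸[m∸n]≡n (J-≤m i i≤r)))
    J′⊆J : ImageWithin r J′ J
    J′⊆J i i≤r = ∈js⇒J (∈js⇒m∸∈js (J∈js (r ∸ i) (ℕP.m∸n≤m r i)))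
    J≡J′ : ∀ ρ → ρ ≤ r → J ρ ≡ J′ ρ
    J≡J′ = enumerations-agree J-strictMono J′-strictMono J⊆J′ J′⊆J

  a-block : ∀ ρ → suc ρ ≤ r → a (suc (J ρ)) ≡ a (J (suc ρ))
  a-block ρ ρ<r = trans (go (J (suc ρ) ∸ suc (J ρ)) (ℕP.≤-reflexive (ℕP.m∸n+n≡m J<J'))) (cong a (ℕP.m∸n+n≡m J<J'))
    where
    J<J' : suc (J ρ) ≤ J (suc ρ)
    J<J' = J-strictMono ρ (suc ρ) ℕP.≤-refl ρ<r
    no-jump : ∀ j → J ρ < j → j < J (suc ρ) → a j ≡ a (suc j)
    no-jump j J<j j<J' with a j <? a (suc j)
    ... | no ¬jump = ℕP.≤-antisym (a-monotone j (suc j) (ℕP.≤-trans (s≤s z≤n) J<j) (ℕP.n≤1+n j) j<m) (ℕP.≮⇒≥ ¬jump)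
      where
      j<m : suc j ≤ m
      j<m = ℕP.≤-trans j<J' (J-≤m (suc ρ) ρ<r)
    ... | yes jump with ∈js⇒J (IsJump⇒∈js (ℕP.≤-trans (s≤s z≤n) J<j , ≤m∸1 , jump))
      where
      ≤m∸1 : j ≤ m ∸ 1
      ≤m∸1 = ℕP.≤-pred (subst (_ ≤_) (sym (ℕP.m+[n∸m]≡n 1≤m)) (ℕP.<-≤-trans j<J' (J-≤m (suc ρ) ρ<r)))
    ...   | σ , σ≤r , Jσ≡j with σ ℕP.≤? ρ
    ...     | yes σ≤ρ = ⊥-elim (ℕP.<-irrefl refl
                (ℕP.≤-<-trans (subst (_≤ J ρ) Jσ≡j (J-monotone σ ρ σ≤ρ (ℕP.≤-trans (ℕP.n≤1+n ρ) ρ<r))) J<j))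
    ...     | no σ≰ρ = ⊥-elim (ℕP.<-irrefl refl
                (ℕP.<-≤-trans j<J' (subst (J (suc ρ) ≤_) Jσ≡j (J-monotone (suc ρ) σ (ℕP.≰⇒> σ≰ρ) σ≤r))))
    go : ∀ d → d ℕ.+ suc (J ρ) ≤ J (suc ρ) → a (suc (J ρ)) ≡ a (d ℕ.+ suc (J ρ))
    go zero    _ = refl
    go (suc d) d+J<J' = trans (go d (ℕP.<⇒≤ d+J<J')) (no-jump (d ℕ.+ suc (J ρ)) (ℕP.m≤n+m (suc (J ρ)) d) d+J<J')

module Interleaving where
  open import Data.Integer using (_≤_)

  interleave-odd : ∀ (f g : ℕ → ℤ) p → interleave f g (suc (double p)) ≡ f (suc p)
  interleave-odd f g zero    = refl
  interleave-odd f g (suc p) = interleave-odd (λ k → f (suc k)) (λ k → g (suc k)) p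

  interleave-even : ∀ (f g : ℕ → ℤ) p → interleave f g (suc (suc (double p))) ≡ g (suc p)
  interleave-even f g zero    = refl
  interleave-even f g (suc p) = interleave-even (λ k → f (suc k)) (λ k → g (suc k)) p

  private
    odd-or-even : ∀ i → 1 ℕ.≤ i → ∃ λ p → i ≡ suc (double p) ⊎ i ≡ suc (suc (double p))
    odd-or-even (suc i) _ with even-or-odd i
    ... | p , inj₁ e = p , inj₁ (cong suc e)
    ... | p , inj₂ e = p , inj₂ (cong suc e)

    double-cancel-≤ : ∀ {p R} → double p ℕ.≤ double R → p ℕ.≤ R
    double-cancel-≤ {zero}              _               = z≤n
    double-cancel-≤ {suc p} {suc R} (s≤s (s≤s 2p≤2R)) = s≤s (double-cancel-≤ 2p≤2R)

    suc-double≤double⇒< : ∀ p R → suc (double p) ℕ.≤ double R → p ℕ.< R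
    suc-double≤double⇒< zero    (suc R) _                  = s≤s z≤n
    suc-double≤double⇒< (suc p) (suc R) (s≤s (s≤s 2p<2R)) = s≤s (suc-double≤double⇒< p R 2p<2R)

    double∸double : ∀ R p → p ℕ.< R → double R ∸ double p ≡ suc (suc (double (R ∸ suc p)))
    double∸double (suc R) zero    _         = refl
    double∸double (suc R) (suc p) (s≤s p<R) = double∸double R p p<R

    double∸suc-double : ∀ R p → p ℕ.< R → double R ∸ suc (double p) ≡ suc (double (R ∸ suc p))
    double∸suc-double (suc R) zero    _         = refl
    double∸suc-double (suc R) (suc p) (s≤s p<R) = double∸suc-double R p p<R

    R∸[R∸p]≡p : ∀ R p → p ℕ.< R → R ∸ suc (R ∸ suc p) ≡ p
    R∸[R∸p]≡p (suc R) p (s≤s p<R) = ℕP.m∸[m∸n]≡n p<R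

    R∸p<R : ∀ R p → p ℕ.< R → R ∸ suc p ℕ.< R
    R∸p<R (suc R) p _ = s≤s (ℕP.m∸n≤m R p)

  module _ (f g : ℕ → ℤ) (R : ℕ) where

    -- Position 2p + 1 (value f (p + 1)) is reflected to 2(R - p) (value g (R - p)).
    interleave-reflect : ∀ c → (∀ p → p ℕ.< R → f (suc p) + g (suc (R ∸ suc p)) ≡ c) →
                         ∀ i → 1 ℕ.≤ i → i ℕ.≤ 2 ℕ.* R → interleave f g i + interleave f g (suc (2 ℕ.* R) ∸ i) ≡ c
    interleave-reflect c pair i 1≤i i≤2R rewrite sym (double≡2* R) with odd-or-even i 1≤i
    ... | p , inj₁ refl = trans (cong₂ _+_ (interleave-odd f g p)
                                           (trans (cong (interleave f g) (double∸double R p p<R))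
                                                  (interleave-even f g (R ∸ suc p))))
                                (pair p p<R)
      where
      p<R : p ℕ.< R
      p<R = suc-double≤double⇒< p R i≤2R
    ... | p , inj₂ refl = trans (cong₂ _+_ (interleave-even f g p)
                                           (trans (cong (interleave f g) (double∸suc-double R p p<R))
                                                  (interleave-odd f g (R ∸ suc p))))
                         (trans (ℤP.+-comm (g (suc p)) (f (suc (R ∸ suc p))))
                         (trans (cong (λ t → f (suc (R ∸ suc p)) + g (suc t)) (sym (R∸[R∸p]≡p R p p<R)))
                                (pair (R ∸ suc p) (R∸p<R R p p<R))))
      where
      p<R : p ℕ.< R
      p<R = double-cancel-≤ {suc p} i≤2R

    interleave-antitone : (∀ p → p ℕ.< R → g (suc p) ≤ f (suc p)) →
                          (∀ p → suc p ℕ.< R → f (suc (suc p)) ≤ g (suc p)) →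
                          ∀ i → 1 ℕ.≤ i → i ℕ.< 2 ℕ.* R → interleave f g (suc i) ≤ interleave f g i
    interleave-antitone g≤f f≤g i 1≤i i<2R rewrite sym (double≡2* R) with odd-or-even i 1≤i
    ... | p , inj₁ refl = subst₂ _≤_ (sym (interleave-even f g p)) (sym (interleave-odd f g p))
                                 (g≤f p (double-cancel-≤ {suc p} i<2R))
    ... | p , inj₂ refl = subst₂ _≤_ (sym (interleave-odd f g (suc p))) (sym (interleave-even f g p))
                                 (f≤g p (suc-double≤double⇒< (suc p) R i<2R))

    interleave-InX0+ : ∀ c → (∀ p → p ℕ.< R → f (suc p) + g (suc (R ∸ suc p)) ≡ c) →
                       (∀ p → p ℕ.< R → g (suc p) ≤ f (suc p)) →
                       (∀ p → suc p ℕ.< R → f (suc (suc p)) ≤ g (suc p)) → InX0+ (2 ℕ.* R) (interleave f g)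
    interleave-InX0+ c pair g≤f f≤g = interleave-antitone g≤f f≤g , c , interleave-reflect c pair

open Interleaving

module UV {n m w l w' l'} (1≤n : 1 ℕ.≤ n) (1≤m : 1 ℕ.≤ m) (hl : InL0+ n w l) (hl' : InL0+ m w' l')
          {a : ℕ → ℕ} (pa : IsPosTuple n m l l' a)
          (l≢l' : ∀ i j → 1 ℕ.≤ i → i ℕ.≤ n → 1 ℕ.≤ j → j ℕ.≤ m → l i ≢ l' j) (s : ℤ) where
  open import Data.Integer using (_≤_)
  open Positions 1≤n hl hl' pa l≢l'
  open JumpIndices 1≤m a-monotone a-reflect a≤n
  private
    module Wn = Weight hl

  uOdd uEven vOdd vEven : ℕ → ℤ
  uOdd  ρ = muˇ n w l (a (J ρ))
  uEven ρ = muˇ n w l (suc (a (J ρ)))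
  vOdd  ρ = lam m w' l' a (suc (J (ρ ∸ 1))) - s
  vEven ρ = lam m w' l' a (J ρ) - s

  private
    1≤J[p+1] : ∀ p → p ℕ.< r → 1 ℕ.≤ J (suc p)
    1≤J[p+1] p p<r = J-≥1 (suc p) (s≤s z≤n) p<r

    J[p]<m : ∀ p → p ℕ.< r → suc (J p) ℕ.≤ m
    J[p]<m p p<r = ℕP.≤-trans (J-strictMono p (suc p) ℕP.≤-refl p<r) (J-≤m (suc p) p<r)

    J-reflect′ : ∀ p → p ℕ.< r → J (suc (r ∸ suc p)) ≡ suc m ∸ suc (J p)
    J-reflect′ p p<r = trans (cong J (sym (ℕP.+-∸-assoc 1 p<r))) (J-reflect p (ℕP.<⇒≤ p<r))

  u-pair : ∀ p → p ℕ.< r → uOdd (suc p) + uEven (suc (r ∸ suc p)) ≡ - w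
  u-pair p p<r = begin
    uOdd (suc p) + muˇ n w l (suc (a (J (suc (r ∸ suc p)))))
      ≡⟨ cong (λ t → uOdd (suc p) + muˇ n w l (suc t)) a∘J≡ ⟩
    uOdd (suc p) + muˇ n w l (suc (n ∸ x))
      ≡⟨ cong (λ t → uOdd (suc p) + muˇ n w l t) (sym (ℕP.+-∸-assoc 1 x≤n)) ⟩
    uOdd (suc p) + muˇ n w l (suc n ∸ x)
      ≡⟨ Wn.muˇ-reflect x (1≤a _ (1≤J[p+1] p p<r) (J-≤m (suc p) p<r)) x≤n ⟩
    - w
      ∎
    where
    open ≡-Reasoning
    x = a (J (suc p))
    x≤n : x ℕ.≤ n
    x≤n = a≤n _ (1≤J[p+1] p p<r) (J-≤m (suc p) p<r)
    a∘J≡ : a (J (suc (r ∸ suc p))) ≡ n ∸ x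
    a∘J≡ = trans (cong a (J-reflect′ p p<r))
                 (trans (a-reflect (suc (J p)) (s≤s z≤n) (J[p]<m p p<r)) (cong (n ∸_) (a-block p p<r)))

  v-pair : ∀ p → p ℕ.< r → vOdd (suc p) + vEven (suc (r ∸ suc p)) ≡ w' + + n - + m - + 1 - + 2 * s
  v-pair p p<r = begin
    vOdd (suc p) + (lam m w' l' a (J (suc (r ∸ suc p))) - s)
      ≡⟨ cong (λ t → vOdd (suc p) + (lam m w' l' a t - s)) (J-reflect′ p p<r) ⟩
    (λ₁ - s) + (λ₂ - s)
      ≡⟨ regroup λ₁ λ₂ s ⟩
    (λ₁ + λ₂) - + 2 * s
      ≡⟨ cong (_- + 2 * s) (lam-reflect (suc (J p)) (s≤s z≤n) (J[p]<m p p<r)) ⟩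
    w' + + n - + m - + 1 - + 2 * s
      ∎
    where
    open ≡-Reasoning
    λ₁ = lam m w' l' a (suc (J p))
    λ₂ = lam m w' l' a (suc m ∸ suc (J p))
    regroup : ∀ A B s → (A - s) + (B - s) ≡ (A + B) - + 2 * s
    regroup = solve-∀

  uEven≤uOdd : ∀ p → p ℕ.< r → uEven (suc p) ≤ uOdd (suc p)
  uEven≤uOdd p p<r = Wn.muˇ-antitone _ _ (1≤a _ 1≤J (J-≤m (suc p) p<r)) (ℕP.n≤1+n _) (a<n _ 1≤J (J-≤m (suc p) p<r))
    where
    1≤J = 1≤J[p+1] p p<r

  uOdd≤uEven : ∀ p → suc p ℕ.< r → uOdd (suc (suc p)) ≤ uEven (suc p)
  uOdd≤uEven p p+1<r = Wn.muˇ-antitone _ _ (s≤s z≤n)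
    (ℕP.<-≤-trans (J-jump (suc p) (s≤s z≤n) p+1<r)
                  (a-monotone _ _ (s≤s z≤n) (J-strictMono (suc p) (suc (suc p)) ℕP.≤-refl p+1<r) (J-≤m _ p+1<r)))
    (a≤n _ (J-≥1 _ (s≤s z≤n) p+1<r) (J-≤m _ p+1<r))

  vEven≤vOdd : ∀ p → p ℕ.< r → vEven (suc p) ≤ vOdd (suc p)
  vEven≤vOdd p p<r = ℤP.+-monoˡ-≤ (- s)
    (lam-antitone _ _ (s≤s z≤n) (J-strictMono p (suc p) ℕP.≤-refl p<r) (J-≤m (suc p) p<r))

  vOdd≤vEven : ∀ p → suc p ℕ.< r → vOdd (suc (suc p)) ≤ vEven (suc p)
  vOdd≤vEven p p+1<r = ℤP.+-monoˡ-≤ (- s)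
    (lam-step _ (J-≥1 (suc p) (s≤s z≤n) (ℕP.<⇒≤ p+1<r))
                (subst (J (suc p) ℕ.<_) J-last (J-strictMono (suc p) r p+1<r ℕP.≤-refl)))

  u∈X0+ : InX0+ (2 ℕ.* r) (uVec n w l m a)
  u∈X0+ = interleave-InX0+ uOdd uEven r (- w) u-pair uEven≤uOdd uOdd≤uEven

  v∈X0+ : InX0+ (2 ℕ.* r) (vVec m w' l' a s)
  v∈X0+ = interleave-InX0+ vOdd vEven r _ v-pair vEven≤vOdd vOdd≤vEven

  u-reflect : ∀ i → 1 ℕ.≤ i → i ℕ.≤ 2 ℕ.* r → uVec n w l m a i + uVec n w l m a (suc (2 ℕ.* r) ∸ i) ≡ - w
  u-reflect = interleave-reflect uOdd uEven r (- w) u-pair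

  v-reflect : ∀ i → 1 ℕ.≤ i → i ℕ.≤ 2 ℕ.* r →
              vVec m w' l' a s i + vVec m w' l' a s (suc (2 ℕ.* r) ∸ i) ≡ w' + + n - + m - + 1 - + 2 * s
  v-reflect = interleave-reflect vOdd vEven r _ v-pair

open import Data.Nat using (_≤_)
open import Data.Integer using (_<_)

lemma5p1 : (n m : ℕ) → 1 ≤ n → 1 ≤ m →
    (w : ℤ) (l : ℕ → ℤ) → InL0+ n w l →
    (w' : ℤ) (l' : ℕ → ℤ) → InL0+ m w' l' →
    (δ δ' : ℕ) → δ ≤ 1 → δ' ≤ 1 →
    ¬ (Odd n × Odd m) →
    (∃ λ S → Critical n m (tensor (piW n w l δ) (piW m w' l' δ')) S) →
    l' 1 < l 1 →
    (Σ (ℕ → ℕ) λ a → IsPosTuple n m l l' a)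
    × (∀ a → IsPosTuple n m l l' a → ∀ (s : ℤ) →
         InX0+ (2 Data.Nat.* rr m a) (uVec n w l m a)
         × InX0+ (2 Data.Nat.* rr m a) (vVec m w' l' a s)
         × (∀ i → 1 ≤ i → i ≤ 2 Data.Nat.* rr m a →
              uVec n w l m a i ℤ.+ uVec n w l m a (suc (2 Data.Nat.* rr m a) ∸ i) ≡ - w)
         × (∀ i → 1 ≤ i → i ≤ 2 Data.Nat.* rr m a →
              vVec m w' l' a s i ℤ.+ vVec m w' l' a s (suc (2 Data.Nat.* rr m a) ∸ i)
                ≡ w' ℤ.+ + n - + m - + 1 - (+ 2) ℤ.* s))
lemma5p1 n m 1≤n 1≤m w l hl w' l' hl' δ δ' _ _ not-both-odd (S , critical) l'₁<l₁ =
  (positionTuple , positionTuple-isPosTuple) ,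
  λ a pa s → let open UV 1≤n 1≤m hl hl' pa (critical⇒l≢l' hl hl' critical not-both-odd) s
             in u∈X0+ , v∈X0+ , u-reflect , v-reflect
  where open Existence 1≤n 1≤m hl hl' l'₁<l₁
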